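{- Let $G_\omega$ be a weighted star graph with center $x$ and edges (spikes) $xv_1,\dots,xv_n$, $n\ge1$, with weight function $\omega:E(G)\to\{1,2,3,\dots\}$, and suppose $a=\omega(xv_1)$ is the maximum value of $\omega$. Then for every positive integer $t$, $$\pi_t(G_\omega,x)=ta+\sum_{i=2}^{n}\bigl(\omega(xv_i)-1\bigr).$$
   Context: A pebble distribution is a function $p:V(G)\to\mathbb{Z}_{\ge0}$, of size $\sum_w p(w)$. For an edge $yz$, the pebbling move $(y\to z)$ removes $\omega(yz)$ pebbles from $y$ and adds one pebble at $z$. A sequence of moves is executable from $p$ if after each move every vertex has a nonnegative number of pebbles. Vertex $x$ is $t$-reachable from $p$ if some sequence executable from $p$ results in at least $t$ pebbles on $x$. $\pi_t(G_\omega,x)$ is the minimum $m$ such that $x$ is $t$-reachable from every pebble distribution of size $m$. -}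

module Defs where

open import Data.Nat using (ℕ; zero; suc; _+_; _*_; _∸_; _≤_; _<_)
open import Data.Fin using (Fin; zero; suc; _≟_)
open import Data.Vec using (sum; tabulate)
open import Data.Product using (_×_; ∃)
open import Relation.Nullary using (¬_; yes; no)
open import Relation.Binary.PropositionalEquality using (_≡_)

-- A weighted (simple, undirected) graph on the vertex set Fin m, given by a
-- symmetric weight function on ordered pairs: ω y z = 0 means "y z is not an
-- edge", and ω y z ≥ 1 is the weight of the edge yz.
WGraph : ℕ → Set
WGraph m = Fin m → Fin m → ℕ

IsEdge : ∀ {m} → WGraph m → Fin m → Fin m → Set
IsEdge ω y z = 1 ≤ ω y z

Distribution : ℕ → Set
Distribution m = Fin m → ℕ

size : ∀ {m} → Distribution m → ℕ
size {m} p = sum (tabulate p)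

move : ∀ {m} → Distribution m → Fin m → Fin m → ℕ → Distribution m
move p y z w v with v ≟ y
... | yes _ = p v ∸ w
... | no _ with v ≟ z
...   | yes _ = suc (p v)
...   | no _ = p v

-- Reachable ω p q : some sequence of pebbling moves executable from p
-- (each move only performed when the source vertex has ≥ ω(yz) pebbles,
-- so every intermediate distribution is nonnegative) results in q.
data Reachable {m} (ω : WGraph m) : Distribution m → Distribution m → Set where
  done : ∀ {p} → Reachable ω p p
  step : ∀ {p q} (y z : Fin m) → IsEdge ω y z → ω y z ≤ p y →
         Reachable ω (move p y z (ω y z)) q → Reachable ω p q

TReachable : ∀ {m} → WGraph m → ℕ → Fin m → Distribution m → Set
TReachable ω t x p = ∃ λ q → Reachable ω p q × t ≤ q x

Solvable : ∀ {m} → WGraph m → ℕ → Fin m → ℕ → Set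
Solvable {m} ω t x k = (p : Distribution m) → size p ≡ k → TReachable ω t x p

IsPebblingNumber : ∀ {m} → WGraph m → ℕ → Fin m → ℕ → Set
IsPebblingNumber ω t x k = Solvable ω t x k × (∀ j → j < k → ¬ Solvable ω t x j)

-- The weighted star with center x = zero and spikes x v_i, where v_i = suc i
-- (i : Fin n) and ω(x v_i) = w i.
star : ∀ {n} → (Fin n → ℕ) → WGraph (suc n)
star w zero    (suc i) = w i
star w (suc i) zero    = w i
star w zero    zero    = 0
star w (suc i) (suc j) = 0

-- The potential φ(p) = p(x) + Σᵢ ⌊p(vᵢ)/ω(xvᵢ)⌋ is exactly the number of pebbles that can be
-- gathered at the center: a move vᵢ → x leaves φ unchanged, a move x → vᵢ costs ω(xvᵢ) ≥ 1 pebbles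
-- at x but raises ⌊p(vᵢ)/ω(xvᵢ)⌋ by at most one, and greedily moving spikes inward realises φ at x.
-- Since p(vᵢ) ≤ a⌊p(vᵢ)/ω(xvᵢ)⌋ + ω(xvᵢ) − 1, every distribution of size ta + Σᵢ₌₂ⁿ(ω(xvᵢ) − 1)
-- has φ ≥ t, whereas every smaller size is attained below the distribution with ta − 1 pebbles on
-- v₁ and ω(xvᵢ) − 1 on vᵢ for i ≥ 2, whose potential is t − 1.
module Submission where

open import Defs
open import Data.Nat using (ℕ; zero; suc; _+_; _*_; _∸_; _≤_)
open import Data.Fin using (Fin; zero; suc)
open import Data.Vec using (sum; tabulate)

open import Data.Nat using (_<_; _⊓_; z≤n; z<s; s≤s⁻¹; _≤?_; NonZero; >-nonZero; >-nonZero⁻¹)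
open import Data.Nat.Properties hiding (_≟_; suc-injective)
open import Data.Nat.DivMod using (_/_; _%_; m≡m%n+[m/n]*n; m%n<n; m/n≡1+[m∸n]/n; /-monoˡ-≤; m<n⇒m/n≡0; m<n*o⇒m/o<n)
open import Data.Nat.Induction using (<-wellFounded)
open import Data.Fin using (_≟_)
open import Data.Fin.Properties using (any?; punchInᵢ≢i; suc-injective)
open import Data.Vec.Functional using (removeAt)
open import Algebra.Properties.Semiring.Sum +-*-semiring
  using (sum-cong-≗; sum-remove; sum-replicate-zero; ∑-distrib-+; *-distribʳ-sum)
  renaming (sum to ∑)
open import Data.Product using (_×_; _,_; ∃)
open import Induction.WellFounded using (Acc; acc)
open import Relation.Nullary using (¬_; yes; no; contradiction)
open import Relation.Binary.PropositionalEquality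
open import Function using (_∘_)

sum-tabulate : ∀ {n} (f : Fin n → ℕ) → sum (tabulate f) ≡ ∑ f
sum-tabulate {zero}  f = refl
sum-tabulate {suc n} f = cong (f zero +_) (sum-tabulate (f ∘ suc))

∑-mono-≤ : ∀ {n} {f g : Fin n → ℕ} → (∀ i → f i ≤ g i) → ∑ f ≤ ∑ g
∑-mono-≤ {zero}  f≤g = z≤n
∑-mono-≤ {suc n} f≤g = +-mono-≤ (f≤g zero) (∑-mono-≤ (f≤g ∘ suc))

∑-zero : ∀ {n} {f : Fin n → ℕ} → (∀ i → f i ≡ 0) → ∑ f ≡ 0
∑-zero {n} f≡0 = trans (sum-cong-≗ f≡0) (sum-replicate-zero n)

-- Stated additively, so that no truncated subtraction occurs.
∑-update : ∀ {n} {f g : Fin n → ℕ} i → (∀ j → j ≢ i → f j ≡ g j) → ∑ f + g i ≡ ∑ g + f i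
∑-update {suc n} {f} {g} i agree = begin
  ∑ f + g i                     ≡⟨ cong (_+ g i) (sum-remove f) ⟩
  f i + ∑ (removeAt f i) + g i  ≡⟨ cong (λ r → f i + r + g i) rest ⟩
  f i + ∑ (removeAt g i) + g i  ≡⟨ swap-ends (f i) (∑ (removeAt g i)) (g i) ⟩
  g i + ∑ (removeAt g i) + f i  ≡⟨ cong (_+ f i) (sum-remove g) ⟨
  ∑ g + f i                     ∎
  where
  open ≡-Reasoning
  rest : ∑ (removeAt f i) ≡ ∑ (removeAt g i)
  rest = sum-cong-≗ (λ j → agree _ (punchInᵢ≢i i j))
  swap-ends : ∀ a r b → a + r + b ≡ b + r + a
  swap-ends a r b = trans (+-comm (a + r) b) (trans (cong (b +_) (+-comm a r)) (sym (+-assoc b r a)))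

m≤[m/n]*o+[n∸1] : ∀ m {n o} .{{_ : NonZero n}} → n ≤ o → m ≤ m / n * o + (n ∸ 1)
m≤[m/n]*o+[n∸1] m {n} {o} n≤o = begin
  m                      ≡⟨ m≡m%n+[m/n]*n m n ⟩
  m % n + m / n * n      ≤⟨ +-mono-≤ (suc[m]≤n⇒m≤pred[n] (m%n<n m n)) (*-monoʳ-≤ (m / n) n≤o) ⟩
  (n ∸ 1) + m / n * o    ≡⟨ +-comm (n ∸ 1) (m / n * o) ⟩
  m / n * o + (n ∸ 1)    ∎
  where open ≤-Reasoning

[1+m]/n≤1+m/n : ∀ m n .{{_ : NonZero n}} → suc m / n ≤ suc (m / n)
[1+m]/n≤1+m/n m n = begin
  suc m / n              ≤⟨ /-monoˡ-≤ n (+-monoˡ-≤ m (>-nonZero⁻¹ n)) ⟩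
  (n + m) / n            ≡⟨ m/n≡1+[m∸n]/n (m≤m+n n m) ⟩
  suc ((n + m ∸ n) / n)  ≡⟨ cong (λ x → suc (x / n)) (m+n∸m≡n n m) ⟩
  suc (m / n)            ∎
  where open ≤-Reasoning

m*o≤n*o+[o∸1]⇒m≤n : ∀ {m n o} → 1 ≤ o → m * o ≤ n * o + (o ∸ 1) → m ≤ n
m*o≤n*o+[o∸1]⇒m≤n {m} {n} {o} 1≤o le = ≮⇒≥ λ n<m →
  <⇒≱ (∸-monoʳ-< z<s 1≤o) (+-cancelˡ-≤ (n * o) o (o ∸ 1) (begin
    n * o + o          ≡⟨ +-comm (n * o) o ⟩
    suc n * o          ≤⟨ *-monoˡ-≤ o n<m ⟩
    m * o              ≤⟨ le ⟩
    n * o + (o ∸ 1)    ∎))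
  where open ≤-Reasoning

fill : ∀ {n} → (Fin n → ℕ) → ℕ → Fin n → ℕ
fill cap r zero    = cap zero ⊓ r
fill cap r (suc i) = fill (cap ∘ suc) (r ∸ cap zero) i

fill-≤ : ∀ {n} (cap : Fin n → ℕ) r i → fill cap r i ≤ cap i
fill-≤ cap r zero    = m⊓n≤m (cap zero) r
fill-≤ cap r (suc i) = fill-≤ (cap ∘ suc) (r ∸ cap zero) i

∑-fill : ∀ {n} (cap : Fin n → ℕ) {r} → r ≤ ∑ cap → ∑ (fill cap r) ≡ r
∑-fill {zero}  cap {zero} r≤∑cap = refl
∑-fill {suc n} cap {r}    r≤∑cap = begin
  cap zero ⊓ r + ∑ (fill (cap ∘ suc) (r ∸ cap zero))  ≡⟨ cong (cap zero ⊓ r +_)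
                                                          (∑-fill (cap ∘ suc) (m≤n+o⇒m∸n≤o r (cap zero) r≤∑cap)) ⟩
  cap zero ⊓ r + (r ∸ cap zero)                       ≡⟨ m⊓n+n∸m≡n (cap zero) r ⟩
  r                                                   ∎
  where open ≡-Reasoning

move-source : ∀ {m} (p : Distribution m) y z c → move p y z c y ≡ p y ∸ c
move-source p y z c with y ≟ y
... | yes _   = refl
... | no y≢y = contradiction refl y≢y

move-target : ∀ {m} (p : Distribution m) y z c → z ≢ y → move p y z c z ≡ suc (p z)
move-target p y z c z≢y with z ≟ y
... | yes z≡y = contradiction z≡y z≢y
... | no _ with z ≟ z
...   | yes _   = refl
...   | no z≢z = contradiction refl z≢z

move-other : ∀ {m} (p : Distribution m) y z c v → v ≢ y → v ≢ z → move p y z c v ≡ p v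
move-other p y z c v v≢y v≢z with v ≟ y
... | yes v≡y = contradiction v≡y v≢y
... | no _ with v ≟ z
...   | yes v≡z = contradiction v≡z v≢z
...   | no _    = refl

module Star {n} (w : Fin n → ℕ) (w-pos : ∀ i → 1 ≤ w i) where

  instance
    w-nonZero : ∀ {i} → NonZero (w i)
    w-nonZero {i} = >-nonZero (w-pos i)

  floors : Distribution (suc n) → Fin n → ℕ
  floors p i = p (suc i) / w i

  potential : Distribution (suc n) → ℕ
  potential p = p zero + ∑ (floors p)

  spikeMass : Distribution (suc n) → ℕ
  spikeMass p = ∑ (p ∘ suc)

  private
    suc≢suc : ∀ {i j : Fin n} → j ≢ i → Fin.suc j ≢ suc i
    suc≢suc j≢i = j≢i ∘ suc-injective

  potential-inward : ∀ p i → w i ≤ p (suc i) → potential (move p (suc i) zero (w i)) ≡ potential p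
  potential-inward p i w≤p = begin
    p′ zero + ∑ (floors p′)       ≡⟨ cong (_+ ∑ (floors p′)) (move-target p (suc i) zero (w i) λ ()) ⟩
    suc (p zero) + ∑ (floors p′)  ≡⟨ +-suc (p zero) _ ⟨
    p zero + suc (∑ (floors p′))  ≡⟨ cong (p zero +_) ∑-drop ⟩
    p zero + ∑ (floors p)         ∎
    where
    open ≡-Reasoning
    p′ = move p (suc i) zero (w i)
    floor-drop : floors p i ≡ suc (floors p′ i)
    floor-drop = trans (m/n≡1+[m∸n]/n w≤p)
                       (cong (λ m → suc (m / w i)) (sym (move-source p (suc i) zero (w i))))
    ∑-drop : suc (∑ (floors p′)) ≡ ∑ (floors p)
    ∑-drop = +-cancelʳ-≡ (floors p′ i) _ _ (begin
      suc (∑ (floors p′)) + floors p′ i  ≡⟨ +-suc (∑ (floors p′)) _ ⟨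
      ∑ (floors p′) + suc (floors p′ i)  ≡⟨ cong (∑ (floors p′) +_) floor-drop ⟨
      ∑ (floors p′) + floors p i         ≡⟨ ∑-update i (λ j j≢i → cong (_/ w j)
                                              (move-other p (suc i) zero (w i) (suc j) (suc≢suc j≢i) λ ())) ⟩
      ∑ (floors p) + floors p′ i         ∎)

  potential-outward : ∀ p i → w i ≤ p zero → potential (move p zero (suc i) (w i)) ≤ potential p
  potential-outward p i w≤p = begin
    p′ zero + ∑ (floors p′)              ≡⟨ cong (_+ ∑ (floors p′)) (move-source p zero (suc i) (w i)) ⟩
    (p zero ∸ w i) + ∑ (floors p′)       ≤⟨ +-monoʳ-≤ (p zero ∸ w i) ∑-rise ⟩
    (p zero ∸ w i) + suc (∑ (floors p))  ≡⟨ +-suc (p zero ∸ w i) _ ⟩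
    suc (p zero ∸ w i) + ∑ (floors p)    ≤⟨ +-monoˡ-≤ (∑ (floors p)) (∸-monoʳ-< (w-pos i) w≤p) ⟩
    p zero + ∑ (floors p)                ∎
    where
    open ≤-Reasoning
    p′ = move p zero (suc i) (w i)
    floor-rise : floors p′ i ≤ suc (floors p i)
    floor-rise = subst (λ m → m / w i ≤ suc (floors p i)) (sym (move-target p zero (suc i) (w i) λ ()))
                       ([1+m]/n≤1+m/n (p (suc i)) (w i))
    ∑-rise : ∑ (floors p′) ≤ suc (∑ (floors p))
    ∑-rise = +-cancelʳ-≤ (floors p i) _ _ (begin
      ∑ (floors p′) + floors p i       ≡⟨ ∑-update i (λ j j≢i → cong (_/ w j)
                                            (move-other p zero (suc i) (w i) (suc j) (λ ()) (suc≢suc j≢i))) ⟩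
      ∑ (floors p) + floors p′ i       ≤⟨ +-monoʳ-≤ (∑ (floors p)) floor-rise ⟩
      ∑ (floors p) + suc (floors p i)  ≡⟨ +-suc (∑ (floors p)) _ ⟩
      suc (∑ (floors p)) + floors p i  ∎)

  spikeMass-inward : ∀ p i → w i ≤ p (suc i) → spikeMass (move p (suc i) zero (w i)) < spikeMass p
  spikeMass-inward p i w≤p = +-cancelʳ-< (p (suc i)) _ _ (begin-strict
    spikeMass p′ + p (suc i)         ≡⟨ ∑-update i (λ j j≢i →
                                          move-other p (suc i) zero (w i) (suc j) (suc≢suc j≢i) λ ()) ⟩
    spikeMass p + p′ (suc i)         ≡⟨ cong (spikeMass p +_) (move-source p (suc i) zero (w i)) ⟩
    spikeMass p + (p (suc i) ∸ w i)  <⟨ +-monoʳ-< (spikeMass p) (∸-monoʳ-< (w-pos i) w≤p) ⟩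
    spikeMass p + p (suc i)          ∎)
    where
    open ≤-Reasoning
    p′ = move p (suc i) zero (w i)

  potential-antitone : ∀ {p q} → Reachable (star w) p q → potential q ≤ potential p
  potential-antitone done = ≤-refl
  potential-antitone (step zero    zero    () _ _)
  potential-antitone (step (suc i) (suc j) () _ _)
  potential-antitone {p} (step (suc i) zero _ w≤p p′↝q) =
    ≤-trans (potential-antitone p′↝q) (≤-reflexive (potential-inward p i w≤p))
  potential-antitone {p} (step zero (suc i) _ w≤p p′↝q) =
    ≤-trans (potential-antitone p′↝q) (potential-outward p i w≤p)

  collect : ∀ p → Acc _<_ (spikeMass p) → ∃ λ q → Reachable (star w) p q × potential p ≤ q zero
  collect p (acc rec) with any? (λ i → w i ≤? p (suc i))
  ... | yes (i , w≤p) with collect (move p (suc i) zero (w i)) (rec (spikeMass-inward p i w≤p))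
  ...   | q , p′↝q , potential≤q =
    q , step (suc i) zero (w-pos i) w≤p p′↝q , subst (_≤ q zero) (potential-inward p i w≤p) potential≤q
  collect p (acc rec) | no stuck = p , done , ≤-reflexive (begin
    p zero + ∑ (floors p)  ≡⟨ cong (p zero +_) (∑-zero λ i → m<n⇒m/n≡0 (≰⇒> λ w≤p → stuck (i , w≤p))) ⟩
    p zero + 0             ≡⟨ +-identityʳ (p zero) ⟩
    p zero                 ∎)
    where open ≡-Reasoning

  t≤potential⇒t-reachable : ∀ {t} p → t ≤ potential p → TReachable (star w) t zero p
  t≤potential⇒t-reachable p t≤potential with collect p (<-wellFounded (spikeMass p))
  ... | q , p↝q , potential≤q = q , p↝q , ≤-trans t≤potential potential≤q

  t-reachable⇒t≤potential : ∀ {t} p → TReachable (star w) t zero p → t ≤ potential p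
  t-reachable⇒t≤potential p (q , p↝q , t≤q) =
    ≤-trans t≤q (≤-trans (m≤m+n (q zero) _) (potential-antitone p↝q))

module HeaviestFirstSpike {k} (w : Fin (suc k) → ℕ) (w-pos : ∀ i → 1 ≤ w i) (w≤a : ∀ i → w i ≤ w zero) where
  open Star w w-pos public

  a : ℕ
  a = w zero

  excess : ℕ
  excess = ∑ (λ i → w (suc i) ∸ 1)

  size≡center+spikeMass : ∀ p → size p ≡ p zero + spikeMass p
  size≡center+spikeMass p = sum-tabulate p

  spikeMass≤∑floors*a+[a∸1]+excess : ∀ p → spikeMass p ≤ ∑ (floors p) * a + ((a ∸ 1) + excess)
  spikeMass≤∑floors*a+[a∸1]+excess p = begin
    ∑ (p ∘ suc)                                    ≤⟨ ∑-mono-≤ (λ i → m≤[m/n]*o+[n∸1] (p (suc i)) (w≤a i)) ⟩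
    ∑ (λ i → floors p i * a + (w i ∸ 1))           ≡⟨ ∑-distrib-+ (λ i → floors p i * a) (λ i → w i ∸ 1) ⟩
    ∑ (λ i → floors p i * a) + ((a ∸ 1) + excess)  ≡⟨ cong (_+ ((a ∸ 1) + excess)) (*-distribʳ-sum a (floors p)) ⟨
    ∑ (floors p) * a + ((a ∸ 1) + excess)          ∎
    where open ≤-Reasoning

  size≤potential*a+[a∸1]+excess : ∀ p → size p ≤ potential p * a + (a ∸ 1) + excess
  size≤potential*a+[a∸1]+excess p = begin
    size p                                                ≡⟨ size≡center+spikeMass p ⟩
    p zero + spikeMass p                                  ≤⟨ +-mono-≤ (m≤m*n (p zero) a)
                                                               (spikeMass≤∑floors*a+[a∸1]+excess p) ⟩
    p zero * a + (∑ (floors p) * a + ((a ∸ 1) + excess))  ≡⟨ +-assoc (p zero * a) _ _ ⟨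
    p zero * a + ∑ (floors p) * a + ((a ∸ 1) + excess)    ≡⟨ cong (_+ ((a ∸ 1) + excess))
                                                               (*-distribʳ-+ a (p zero) _) ⟨
    potential p * a + ((a ∸ 1) + excess)                  ≡⟨ +-assoc (potential p * a) (a ∸ 1) excess ⟨
    potential p * a + (a ∸ 1) + excess                    ∎
    where open ≤-Reasoning

  size≡t*a+excess⇒t≤potential : ∀ {t} p → size p ≡ t * a + excess → t ≤ potential p
  size≡t*a+excess⇒t≤potential {t} p size≡ = m*o≤n*o+[o∸1]⇒m≤n (w-pos zero)
    (+-cancelʳ-≤ excess (t * a) _
      (subst (_≤ potential p * a + (a ∸ 1) + excess) size≡ (size≤potential*a+[a∸1]+excess p)))

  critical : ℕ → Fin (suc k) → ℕ
  critical t zero    = t * a ∸ 1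
  critical t (suc i) = w (suc i) ∸ 1

  belowCritical : ℕ → ℕ → Distribution (suc (suc k))
  belowCritical t j zero    = 0
  belowCritical t j (suc i) = fill (critical t) j i

  module _ {t} (t≥1 : 1 ≤ t) where

    instance
      t*a-nonZero : NonZero (t * a)
      t*a-nonZero = >-nonZero (*-mono-≤ t≥1 (w-pos zero))

    size-belowCritical : ∀ {j} → j < t * a + excess → size (belowCritical t j) ≡ j
    size-belowCritical {j} j< =
      trans (size≡center+spikeMass (belowCritical t j)) (∑-fill (critical t) j≤∑critical)
      where
      j≤∑critical : j ≤ (t * a ∸ 1) + excess
      j≤∑critical = s≤s⁻¹ (subst (λ m → j < m + excess) (sym (suc-pred (t * a))) j<)

    potential-belowCritical : ∀ j → potential (belowCritical t j) < t
    potential-belowCritical j = begin-strict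
      ∑ (floors p)                 ≡⟨ cong (floors p zero +_) (∑-zero λ i →
                                        m<n⇒m/n≡0 (m≤pred[n]⇒suc[m]≤n (fill-≤ (critical t) j (suc i)))) ⟩
      floors p zero + 0            ≡⟨ +-identityʳ (floors p zero) ⟩
      fill (critical t) j zero / a <⟨ m<n*o⇒m/o<n (m≤pred[n]⇒suc[m]≤n (fill-≤ (critical t) j zero)) ⟩
      t                            ∎
      where
      open ≤-Reasoning
      p = belowCritical t j

proposition5p1 : (k : ℕ) (w : Fin (suc k) → ℕ) →
    (∀ i → 1 ≤ w i) → (∀ i → w i ≤ w zero) →
    (t : ℕ) → 1 ≤ t →
    IsPebblingNumber (star w) t zero (t * w zero + sum (tabulate (λ i → w (suc i) ∸ 1)))
proposition5p1 k w w-pos w≤a t t≥1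
  rewrite sum-tabulate (λ i → w (suc i) ∸ 1) = solvable , unsolvable-below
  where
  open HeaviestFirstSpike w w-pos w≤a

  solvable : Solvable (star w) t zero (t * a + excess)
  solvable p size≡ = t≤potential⇒t-reachable p (size≡t*a+excess⇒t≤potential p size≡)

  unsolvable-below : ∀ j → j < t * a + excess → ¬ Solvable (star w) t zero j
  unsolvable-below j j< solvable-j =
    <⇒≱ (potential-belowCritical t≥1 j)
        (t-reachable⇒t≤potential p (solvable-j p (size-belowCritical t≥1 j<)))
    where p = belowCritical t j
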